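{- For every integer $n\ge2$ that is a power of 2, $\mathsf{Pat}^{\mathsf{M}}(\mathsf{ADDR}_n)\geq 2^n$.
   Context: $\mathsf{ADDR}_n:\{0,1\}^{\log n+n}\to\{0,1\}$ is $\mathsf{ADDR}_n(x,y)=y_{\mathsf{bin}(x)}$ for $x\in\{0,1\}^{\log n}$, $y\in\{0,1\}^n$, where $\mathsf{bin}(x)$ is the index in $[n]$ encoded in binary by $x$. Every Boolean function $f$ on $N$ variables has a unique real expansion $f=\sum_{S\subseteq[N]}\widetilde f(S)\mathsf{AND}_S$ with $\mathsf{AND}_S(z)=\prod_{i\in S}z_i$; its Möbius support is $\mathcal{S}_f=\{S:\widetilde f(S)\neq0\}$. The pattern of $z$ is $(\mathsf{AND}_S(z))_{S\in\mathcal{S}_f}$, and $\mathsf{Pat}^{\mathsf{M}}(f)$ is the number of distinct patterns over all inputs $z\in\{0,1\}^N$. -}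

module Defs where

open import Data.Bool using (Bool; true; false; _∧_; _∨_; not; if_then_else_)
open import Data.Bool.Properties using () renaming (_≟_ to _≟B_)
open import Data.Nat using (ℕ; zero; suc; _+_; _^_)
open import Data.Fin using (Fin; zero; suc; _↑ˡ_; _↑ʳ_)
open import Data.Vec using (Vec; []; _∷_; lookup; take; drop; zipWith; foldr)
open import Data.List using (List; []; _∷_; map; concatMap; filterᵇ; deduplicate; length)
import Data.List.Properties as LP
open import Data.Integer using (ℤ; 0ℤ; 1ℤ; -_) renaming (_+_ to _+ℤ_; _≟_ to _≟ℤ_)
open import Relation.Nullary.Decidable using (does)

-- All Boolean vectors of length m (inputs z ∈ {0,1}^m, and also
-- subsets S ⊆ [m] given by their indicator vectors).
allVecs : (m : ℕ) → List (Vec Bool m)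
allVecs zero    = [] ∷ []
allVecs (suc m) = concatMap (λ v → (false ∷ v) ∷ (true ∷ v) ∷ []) (allVecs m)

AND : ∀ {m} → Vec Bool m → Vec Bool m → Bool
AND S z = foldr _ _∧_ true (zipWith (λ s b → not s ∨ b) S z)

_⊆ᵇ_ : ∀ {m} → Vec Bool m → Vec Bool m → Bool
T ⊆ᵇ S = AND T S

parity : ∀ {m} → Vec Bool m → Bool
parity = foldr _ (λ b p → if b then not p else p) false

boolℤ : Bool → ℤ
boolℤ true  = 1ℤ
boolℤ false = 0ℤ

sumℤ : List ℤ → ℤ
sumℤ []       = 0ℤ
sumℤ (x ∷ xs) = x +ℤ sumℤ xs

-- Möbius coefficient: f̃(S) = Σ_{T ⊆ S} (-1)^{|S|-|T|} f(1_T)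
-- (the unique coefficients of f = Σ_S f̃(S) AND_S, by Möbius inversion).
mobius : ∀ {m} → (Vec Bool m → Bool) → Vec Bool m → ℤ
mobius {m} f S =
  sumℤ (map (λ T → let v = boolℤ (f T) in
                    if (parity S ∧ not (parity T)) ∨ (not (parity S) ∧ parity T)
                    then - v else v)
            (filterᵇ (λ T → T ⊆ᵇ S) (allVecs m)))

nonzeroℤ : ℤ → Bool
nonzeroℤ z = not (does (z ≟ℤ 0ℤ))

mobiusSupport : ∀ {m} → (Vec Bool m → Bool) → List (Vec Bool m)
mobiusSupport {m} f = filterᵇ (λ S → nonzeroℤ (mobius f S)) (allVecs m)

pattern' : ∀ {m} → (Vec Bool m → Bool) → Vec Bool m → List Bool
pattern' f z = map (λ S → AND S z) (mobiusSupport f)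

PatM : ∀ {m} → (Vec Bool m → Bool) → ℕ
PatM {m} f = length (deduplicate (LP.≡-dec _≟B_) (map (pattern' f) (allVecs m)))

-- bin : {0,1}^k → Fin (2^k), most significant bit first
bin : ∀ {k} → Vec Bool k → Fin (2 ^ k)
bin []                      = zero
bin {suc k} (false ∷ xs)    = bin xs ↑ˡ (2 ^ k + 0)
bin {suc k} (true  ∷ xs)    = (2 ^ k) ↑ʳ (bin xs ↑ˡ 0)

-- ADDR_n with n = 2^k on log n + n = k + 2^k variables: ADDR(x,y) = y_{bin(x)}
ADDR : (k : ℕ) → Vec Bool (k + 2 ^ k) → Bool
ADDR k xy = lookup (drop k xy) (bin (take k xy))

-- Let Sᵢ consist of all k address variables together with the data variable yᵢ. Below Sᵢ the
-- function ADDR is 1 only at the input whose address is i and whose only data bit is yᵢ, so Möbius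
-- inversion gives ADDR̃(Sᵢ) = ±1 and every Sᵢ lies in the Möbius support. On the inputs (1…1, y)
-- the Sᵢ-entry of the pattern is yᵢ, so the 2ⁿ data words y already have 2ⁿ distinct patterns.
module Submission where

open import Defs
open import Data.Nat using (ℕ; zero; suc; _+_; _≤_; _^_)
open import Data.Nat.Properties using (+-identityʳ)
open import Data.Bool using (Bool; true; false; _∧_; _∨_; not; if_then_else_)
open import Data.Bool.Properties using (T?; T-≡; ∧-identityʳ) renaming (_≟_ to _≟B_)
open import Data.Fin using (Fin; zero; suc; _↑ˡ_; _↑ʳ_; splitAt; cast)
open import Data.Fin.Properties
  using (splitAt-↑ˡ; splitAt-↑ʳ; splitAt⁻¹-↑ˡ; splitAt⁻¹-↑ʳ; toℕ-injective; toℕ-cast; toℕ-↑ˡ; injective⇒≤)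
open import Data.Fin.Subset using (⁅_⁆) renaming (⊥ to ∅; ⊤ to full)
open import Data.Fin.Subset.Properties using (x∈⁅x⁆; x∈⁅y⁆⇒x≡y)
open import Data.Vec using (Vec; []; _∷_; _++_; lookup; take; drop)
import Data.Vec as Vec
open import Data.Vec.Properties
  using (∷-injectiveˡ; ∷-injectiveʳ; take++drop≡id; ++-injectiveˡ; ++-injectiveʳ; lookup-replicate; lookup⇒[]=; []=⇒lookup)
open import Data.Vec.Relation.Binary.Pointwise.Extensional using (ext; Pointwise-≡⇒≡)
open import Data.List using (List; []; _∷_; map; filterᵇ; concatMap; deduplicate; length)
import Data.List as List
import Data.List.Properties as LP
open import Data.List.Membership.Propositional using (_∈_)
open import Data.List.Membership.Propositional.Properties using (∈-deduplicate⁺; ∈-map⁺; ∈-filter⁺; ∈-concatMap⁺)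
open import Data.List.Relation.Unary.Any using (here; there; index)
import Data.List.Relation.Unary.Any as Any
open import Data.List.Relation.Unary.Any.Properties using (lookup-index)
open import Data.Integer using (ℤ; 0ℤ; 1ℤ; -_) renaming (_+_ to _+ℤ_)
open import Data.Integer.Properties using (+-assoc; +-identityˡ) renaming (+-identityʳ to +ℤ-identityʳ)
open import Data.Sum using (_⊎_; inj₁; inj₂)
open import Data.Product using (_,_)
open import Function using (_∘_; Injective)
open import Function.Bundles using (Equivalence)
open import Relation.Nullary using (contradiction)
open import Relation.Binary.PropositionalEquality
open ≡-Reasoning

cast-↑ˡ0 : ∀ {m} (i : Fin m) → cast (+-identityʳ m) (i ↑ˡ 0) ≡ i
cast-↑ˡ0 {m} i = toℕ-injective (trans (toℕ-cast (+-identityʳ m) (i ↑ˡ 0)) (toℕ-↑ˡ i 0))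

↑ˡ0-cast : ∀ {m} (j : Fin (m + 0)) → cast (+-identityʳ m) j ↑ˡ 0 ≡ j
↑ˡ0-cast {m} j = toℕ-injective (trans (toℕ-↑ˡ (cast (+-identityʳ m) j) 0) (toℕ-cast (+-identityʳ m) j))

-- 2 ^ suc n unfolds to 2 ^ n + (2 ^ n + 0); the cast undoes the ↑ˡ 0 that bin applies to the upper half.
unbin : ∀ n → Fin (2 ^ n) → Vec Bool n
unbin zero    _ = []
unbin (suc n) i with splitAt (2 ^ n) i
... | inj₁ j = false ∷ unbin n j
... | inj₂ j = true ∷ unbin n (cast (+-identityʳ (2 ^ n)) j)

bin-unbin : ∀ n (i : Fin (2 ^ n)) → bin (unbin n i) ≡ i
bin-unbin zero    zero = refl
bin-unbin (suc n) i with splitAt (2 ^ n) i in eq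
... | inj₁ j = trans (cong (_↑ˡ _) (bin-unbin n j)) (splitAt⁻¹-↑ˡ eq)
... | inj₂ j = begin
  2 ^ n ↑ʳ (bin (unbin n j′) ↑ˡ 0)  ≡⟨ cong (λ l → 2 ^ n ↑ʳ (l ↑ˡ 0)) (bin-unbin n j′) ⟩
  2 ^ n ↑ʳ (j′ ↑ˡ 0)                ≡⟨ cong (2 ^ n ↑ʳ_) (↑ˡ0-cast j) ⟩
  2 ^ n ↑ʳ j                        ≡⟨ splitAt⁻¹-↑ʳ eq ⟩
  i                                 ∎
  where j′ = cast (+-identityʳ (2 ^ n)) j

unbin-bin : ∀ {n} (x : Vec Bool n) → unbin n (bin x) ≡ x
unbin-bin []                  = refl
unbin-bin {suc n} (false ∷ x) rewrite splitAt-↑ˡ (2 ^ n) (bin x) (2 ^ n + 0) = cong (false ∷_) (unbin-bin x)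
unbin-bin {suc n} (true ∷ x)  rewrite splitAt-↑ʳ (2 ^ n) (2 ^ n + 0) (bin x ↑ˡ 0) | cast-↑ˡ0 (bin x) =
  cong (true ∷_) (unbin-bin x)

unbin-injective : ∀ n → Injective _≡_ _≡_ (unbin n)
unbin-injective n {i} {j} eq = begin
  i                ≡⟨ sym (bin-unbin n i) ⟩
  bin (unbin n i)  ≡⟨ cong bin eq ⟩
  bin (unbin n j)  ≡⟨ bin-unbin n j ⟩
  j                ∎

AND-++ : ∀ {k n} (p z : Vec Bool k) (q w : Vec Bool n) → AND (p ++ q) (z ++ w) ≡ AND p z ∧ AND q w
AND-++ []      []      q w = refl
AND-++ (a ∷ p) (b ∷ z) q w rewrite AND-++ p z q w with not a ∨ b
... | true  = refl
... | false = refl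

∅-⊆ᵇ : ∀ {n} (z : Vec Bool n) → ∅ ⊆ᵇ z ≡ true
∅-⊆ᵇ []      = refl
∅-⊆ᵇ (_ ∷ z) = ∅-⊆ᵇ z

⊆ᵇ-full : ∀ {n} (p : Vec Bool n) → p ⊆ᵇ full ≡ true
⊆ᵇ-full []          = refl
⊆ᵇ-full (true  ∷ p) = ⊆ᵇ-full p
⊆ᵇ-full (false ∷ p) = ⊆ᵇ-full p

⊆ᵇ-∅ : ∀ {n} (p : Vec Bool n) → p ⊆ᵇ ∅ ≡ true → p ≡ ∅
⊆ᵇ-∅ []          _   = refl
⊆ᵇ-∅ (false ∷ p) p⊆∅ = cong (false ∷_) (⊆ᵇ-∅ p p⊆∅)

⊆ᵇ-⁅⁆ : ∀ {n} (i : Fin n) (p : Vec Bool n) → p ⊆ᵇ ⁅ i ⁆ ≡ true → p ≡ ∅ ⊎ p ≡ ⁅ i ⁆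
⊆ᵇ-⁅⁆ zero    (false ∷ p) p⊆i = inj₁ (cong (false ∷_) (⊆ᵇ-∅ p p⊆i))
⊆ᵇ-⁅⁆ zero    (true  ∷ p) p⊆i = inj₂ (cong (true ∷_) (⊆ᵇ-∅ p p⊆i))
⊆ᵇ-⁅⁆ (suc i) (false ∷ p) p⊆i with ⊆ᵇ-⁅⁆ i p p⊆i
... | inj₁ p≡∅ = inj₁ (cong (false ∷_) p≡∅)
... | inj₂ p≡i = inj₂ (cong (false ∷_) p≡i)

AND-⁅⁆ : ∀ {n} (i : Fin n) (z : Vec Bool n) → AND ⁅ i ⁆ z ≡ lookup z i
AND-⁅⁆ zero    (b ∷ z) rewrite ∅-⊆ᵇ z = ∧-identityʳ b
AND-⁅⁆ (suc i) (_ ∷ z) = AND-⁅⁆ i z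

lookup-⁅i⁆-i : ∀ {n} (i : Fin n) → lookup ⁅ i ⁆ i ≡ true
lookup-⁅i⁆-i i = []=⇒lookup (x∈⁅x⁆ i)

lookup-⁅⁆ : ∀ {n} (i j : Fin n) → lookup ⁅ i ⁆ j ≡ true → j ≡ i
lookup-⁅⁆ i j j∈i = x∈⁅y⁆⇒x≡y i (lookup⇒[]= j ⁅ i ⁆ j∈i)

∈-filterᵇ⁺ : ∀ {A : Set} (p : A → Bool) {x : A} {L : List A} →
  x ∈ L → p x ≡ true → x ∈ filterᵇ p L
∈-filterᵇ⁺ p x∈L px = ∈-filter⁺ (T? ∘ p) x∈L (Equivalence.from T-≡ px)

map-≡⇒≡-∈ : ∀ {A B : Set} (g₁ g₂ : A → B) {L : List A} {x : A} →
  map g₁ L ≡ map g₂ L → x ∈ L → g₁ x ≡ g₂ x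
map-≡⇒≡-∈ g₁ g₂ eq (here refl) = LP.∷-injectiveˡ eq
map-≡⇒≡-∈ g₁ g₂ eq (there x∈L) = map-≡⇒≡-∈ g₁ g₂ (LP.∷-injectiveʳ eq) x∈L

injective⇒≤-length : ∀ {A : Set} {N} (L : List A) (h : Fin N → A) →
  Injective _≡_ _≡_ h → (∀ i → h i ∈ L) → N ≤ length L
injective⇒≤-length L h h-injective h∈L = injective⇒≤ index-injective
  where
  index-injective : Injective _≡_ _≡_ (index ∘ h∈L)
  index-injective {i} {j} eq = h-injective (begin
    h i                            ≡⟨ lookup-index (h∈L i) ⟩
    List.lookup L (index (h∈L i))  ≡⟨ cong (List.lookup L) eq ⟩
    List.lookup L (index (h∈L j))  ≡⟨ sym (lookup-index (h∈L j)) ⟩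
    h j                            ∎)

extensions : ∀ {m} → Vec Bool m → List (Vec Bool (suc m))
extensions v = (false ∷ v) ∷ (true ∷ v) ∷ []

∈-allVecs : ∀ {m} (v : Vec Bool m) → v ∈ allVecs m
∈-allVecs []      = here refl
∈-allVecs (b ∷ v) = ∈-concatMap⁺ extensions (Any.map (λ { refl → ∈-extensions b }) (∈-allVecs v))
  where
  ∈-extensions : ∀ b → b ∷ v ∈ extensions v
  ∈-extensions false = here refl
  ∈-extensions true  = there (here refl)

sumℤ-filterᵇ : ∀ {A : Set} (p : A → Bool) (g : A → ℤ) (L : List A) →
  sumℤ (map g (filterᵇ p L)) ≡ sumℤ (map (λ x → if p x then g x else 0ℤ) L)
sumℤ-filterᵇ p g []      = refl
sumℤ-filterᵇ p g (x ∷ L) with p x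
... | true  = cong (g x +ℤ_) (sumℤ-filterᵇ p g L)
... | false = trans (sumℤ-filterᵇ p g L) (sym (+-identityˡ _))

sumℤ-allVecs-suc : ∀ {m} (h : Vec Bool (suc m) → ℤ) →
  sumℤ (map h (allVecs (suc m))) ≡ sumℤ (map (λ v → h (false ∷ v) +ℤ h (true ∷ v)) (allVecs m))
sumℤ-allVecs-suc {m} h = go (allVecs m)
  where
  go : ∀ L → sumℤ (map h (concatMap extensions L))
           ≡ sumℤ (map (λ v → h (false ∷ v) +ℤ h (true ∷ v)) L)
  go []      = refl
  go (v ∷ L) = trans (cong (λ s → h (false ∷ v) +ℤ (h (true ∷ v) +ℤ s)) (go L))
                     (sym (+-assoc (h (false ∷ v)) (h (true ∷ v)) _))

sumBool-δ : (g : Bool → ℤ) (b : Bool) → (∀ c → c ≢ b → g c ≡ 0ℤ) → g false +ℤ g true ≡ g b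
sumBool-δ g false g-vanishes = trans (cong (g false +ℤ_) (g-vanishes true λ ())) (+ℤ-identityʳ _)
sumBool-δ g true  g-vanishes = trans (cong (_+ℤ g true) (g-vanishes false λ ())) (+-identityˡ _)

sumℤ-allVecs-δ : ∀ {m} (h : Vec Bool m → ℤ) (a : Vec Bool m) → (∀ v → v ≢ a → h v ≡ 0ℤ) →
  sumℤ (map h (allVecs m)) ≡ h a
sumℤ-allVecs-δ h []      _ = +ℤ-identityʳ (h [])
sumℤ-allVecs-δ {suc m} h (b ∷ a) h-vanishes = begin
  sumℤ (map h (allVecs (suc m)))                                ≡⟨ sumℤ-allVecs-suc h ⟩
  sumℤ (map (λ v → h (false ∷ v) +ℤ h (true ∷ v)) (allVecs m))  ≡⟨ sumℤ-allVecs-δ _ a pairs-vanish ⟩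
  h (false ∷ a) +ℤ h (true ∷ a)                                 ≡⟨ sumBool-δ (λ c → h (c ∷ a)) b head-vanishes ⟩
  h (b ∷ a)                                                     ∎
  where
  pairs-vanish : ∀ v → v ≢ a → h (false ∷ v) +ℤ h (true ∷ v) ≡ 0ℤ
  pairs-vanish v v≢a = cong₂ _+ℤ_ (h-vanishes _ (v≢a ∘ ∷-injectiveʳ)) (h-vanishes _ (v≢a ∘ ∷-injectiveʳ))

  head-vanishes : ∀ c → c ≢ b → h (c ∷ a) ≡ 0ℤ
  head-vanishes c c≢b = h-vanishes _ (c≢b ∘ ∷-injectiveˡ)

-- signed (oddDifference S T) is the sign (−1)^(|S|−|T|) in mobius, whose summand at T is thus
-- definitionally signed (oddDifference S T) (boolℤ (f T)).
signed : Bool → ℤ → ℤ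
signed c v = if c then - v else v

oddDifference : ∀ {m} → Vec Bool m → Vec Bool m → Bool
oddDifference S T = (parity S ∧ not (parity T)) ∨ (not (parity S) ∧ parity T)

signed-0ℤ : ∀ c → signed c 0ℤ ≡ 0ℤ
signed-0ℤ true  = refl
signed-0ℤ false = refl

signed-1ℤ-nonzero : ∀ c → nonzeroℤ (signed c 1ℤ) ≡ true
signed-1ℤ-nonzero true  = refl
signed-1ℤ-nonzero false = refl

module _ {m} (f : Vec Bool m → Bool) {S a : Vec Bool m}
         (a⊆S : a ⊆ᵇ S ≡ true) (fa : f a ≡ true)
         (unique : ∀ T → T ⊆ᵇ S ≡ true → f T ≡ true → T ≡ a) where

  mobius-unique-true : mobius f S ≡ signed (oddDifference S a) 1ℤ
  mobius-unique-true = begin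
    mobius f S                                ≡⟨ sumℤ-filterᵇ (_⊆ᵇ S) term (allVecs m) ⟩
    sumℤ (map termBelow (allVecs m))          ≡⟨ sumℤ-allVecs-δ termBelow a termBelow-vanishes ⟩
    termBelow a                               ≡⟨ cong (λ b → if b then term a else 0ℤ) a⊆S ⟩
    signed (oddDifference S a) (boolℤ (f a))  ≡⟨ cong (signed (oddDifference S a) ∘ boolℤ) fa ⟩
    signed (oddDifference S a) 1ℤ             ∎
    where
    term termBelow : Vec Bool m → ℤ
    term T = signed (oddDifference S T) (boolℤ (f T))
    termBelow T = if T ⊆ᵇ S then term T else 0ℤ

    termBelow-vanishes : ∀ T → T ≢ a → termBelow T ≡ 0ℤ
    termBelow-vanishes T T≢a with T ⊆ᵇ S in T⊆S | f T in fT
    ... | false | _     = refl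
    ... | true  | false = signed-0ℤ (oddDifference S T)
    ... | true  | true  = contradiction (unique T T⊆S fT) T≢a

  unique-true⇒∈-mobiusSupport : S ∈ mobiusSupport f
  unique-true⇒∈-mobiusSupport = ∈-filterᵇ⁺ (nonzeroℤ ∘ mobius f) (∈-allVecs S)
    (trans (cong nonzeroℤ mobius-unique-true) (signed-1ℤ-nonzero (oddDifference S a)))

2^n≤PatM : ∀ {m n} (f : Vec Bool m → Bool) (g : Vec Bool n → Vec Bool m) →
  Injective _≡_ _≡_ (pattern' f ∘ g) → 2 ^ n ≤ PatM f
2^n≤PatM {m} {n} f g patterns-injective =
  injective⇒≤-length _ (pattern' f ∘ g ∘ unbin n) (unbin-injective n ∘ patterns-injective) occurs
  where
  occurs : ∀ i → pattern' f (g (unbin n i)) ∈ deduplicate (LP.≡-dec _≟B_) (map (pattern' f) (allVecs m))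
  occurs i = ∈-deduplicate⁺ (LP.≡-dec _≟B_) (∈-map⁺ (pattern' f) (∈-allVecs (g (unbin n i))))

module _ (k : ℕ) where

  ADDR-++ : (x : Vec Bool k) (y : Vec Bool (2 ^ k)) → ADDR k (x ++ y) ≡ lookup y (bin x)
  ADDR-++ x y = cong₂ (λ y′ x′ → lookup y′ (bin x′)) (++-injectiveʳ (take k (x ++ y)) x split)
                                                       (++-injectiveˡ (take k (x ++ y)) x split)
    where
    split : take k (x ++ y) ++ drop k (x ++ y) ≡ x ++ y
    split = take++drop≡id k (x ++ y)

  monomial : Fin (2 ^ k) → Vec Bool (k + 2 ^ k)
  monomial i = full ++ ⁅ i ⁆

  pointer : Fin (2 ^ k) → Vec Bool (k + 2 ^ k)
  pointer i = unbin k i ++ ⁅ i ⁆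

  ⊆ᵇ-monomial : ∀ x y i → (x ++ y) ⊆ᵇ monomial i ≡ y ⊆ᵇ ⁅ i ⁆
  ⊆ᵇ-monomial x y i = trans (AND-++ x full y ⁅ i ⁆) (cong (_∧ y ⊆ᵇ ⁅ i ⁆) (⊆ᵇ-full x))

  AND-monomial : ∀ i y → AND (monomial i) (full ++ y) ≡ lookup y i
  AND-monomial i y =
    trans (AND-++ (full {k}) full ⁅ i ⁆ y) (cong₂ _∧_ (⊆ᵇ-full (full {k})) (AND-⁅⁆ i y))

  pointer⊆monomial : ∀ i → pointer i ⊆ᵇ monomial i ≡ true
  pointer⊆monomial i = begin
    pointer i ⊆ᵇ monomial i ≡⟨ ⊆ᵇ-monomial (unbin k i) ⁅ i ⁆ i ⟩
    AND ⁅ i ⁆ ⁅ i ⁆         ≡⟨ AND-⁅⁆ i ⁅ i ⁆ ⟩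
    lookup ⁅ i ⁆ i          ≡⟨ lookup-⁅i⁆-i i ⟩
    true                    ∎

  ADDR-pointer : ∀ i → ADDR k (pointer i) ≡ true
  ADDR-pointer i = begin
    ADDR k (pointer i)              ≡⟨ ADDR-++ (unbin k i) ⁅ i ⁆ ⟩
    lookup ⁅ i ⁆ (bin (unbin k i))  ≡⟨ cong (lookup ⁅ i ⁆) (bin-unbin k i) ⟩
    lookup ⁅ i ⁆ i                  ≡⟨ lookup-⁅i⁆-i i ⟩
    true                            ∎

  ADDR-true⊆monomial⇒pointer : ∀ i T → T ⊆ᵇ monomial i ≡ true → ADDR k T ≡ true → T ≡ pointer i
  -- Splitting T with the splitAt that ADDR itself performs turns ADDR-T into lookup y (bin x) ≡ true.
  ADDR-true⊆monomial⇒pointer i T T⊆S ADDR-T with Vec.splitAt k T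
  ... | x , y , refl with ⊆ᵇ-⁅⁆ i y (trans (sym (⊆ᵇ-monomial x y i)) T⊆S)
  ...   | inj₁ refl = contradiction (trans (sym (lookup-replicate (bin x) false)) ADDR-T) λ ()
  ...   | inj₂ refl =
    cong (_++ ⁅ i ⁆) (trans (sym (unbin-bin x)) (cong (unbin k) (lookup-⁅⁆ i (bin x) ADDR-T)))

  monomial∈mobiusSupport : ∀ i → monomial i ∈ mobiusSupport (ADDR k)
  monomial∈mobiusSupport i = unique-true⇒∈-mobiusSupport (ADDR k) (pointer⊆monomial i) (ADDR-pointer i)
                                                          (ADDR-true⊆monomial⇒pointer i)

  pattern-full++-injective : Injective _≡_ _≡_ (pattern' (ADDR k) ∘ (full ++_))
  pattern-full++-injective {y} {y′} same-pattern = Pointwise-≡⇒≡ (ext λ i → begin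
    lookup y i                     ≡⟨ sym (AND-monomial i y) ⟩
    AND (monomial i) (full ++ y)   ≡⟨ map-≡⇒≡-∈ (λ S → AND S (full ++ y)) (λ S → AND S (full ++ y′))
                                                same-pattern (monomial∈mobiusSupport i) ⟩
    AND (monomial i) (full ++ y′)  ≡⟨ AND-monomial i y′ ⟩
    lookup y′ i                    ∎)

-- The argument works for k = 0 as well.
claim18 : (k : ℕ) → 1 ≤ k → 2 ^ (2 ^ k) ≤ PatM (ADDR k)
claim18 k _ = 2^n≤PatM (ADDR k) (full ++_) (pattern-full++-injective k)
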